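{- Every bounded duplicating TRS is weakly bounded duplicating.
   Context: Let $\mathcal{R}$ be a TRS over $\mathcal{F}$. $\mathcal{R}$ is bounded duplicating if, for a fresh unary symbol $\Diamond$, the relative TRS $\{\Diamond(x)\to x\}/\mathcal{R}$ is terminating. This means there is no infinite rewrite sequence with $\mathcal{R}\cup\{\Diamond(x)\to x\}$ containing infinitely many $\Diamond(x)\to x$ steps. $\mathcal{R}$ is weakly bounded duplicating if, for fresh constants $\top$ and $\bot$, the relative TRS $\{\top\to\bot\}/\mathcal{R}$ is terminating. This means there is no infinite rewrite sequence with $\mathcal{R}\cup\{\top\to\bot\}$ containing infinitely many $\top\to\bot$ steps. -}

module Defs where

open import Data.Nat using (ℕ; suc; _≤_)
open import Data.Fin using (Fin)
open import Data.Vec using (Vec; []; _∷_; lookup; _[_]≔_)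
open import Data.Product using (Σ; ∃; _×_; _,_)
open import Data.Sum using (_⊎_; inj₁; inj₂)
open import Data.Unit using (⊤; tt)
open import Data.Bool using (Bool; true; false)
open import Data.Empty using (⊥)
open import Relation.Nullary using (¬_)
open import Relation.Binary.PropositionalEquality using (_≡_)

record Signature : Set₁ where
  field
    Sym : Set
    ar  : Sym → ℕ
open Signature public

Var : Set
Var = ℕ

data Term (Σ' : Signature) : Set where
  var : Var → Term Σ'
  fun : (f : Sym Σ') → Vec (Term Σ') (ar Σ' f) → Term Σ'

module _ {Σ' : Signature} where

  mutual
    _⟨_⟩ : Term Σ' → (Var → Term Σ') → Term Σ'
    var x    ⟨ σ ⟩ = σ x
    fun f ts ⟨ σ ⟩ = fun f (substs ts σ)

    substs : ∀ {n} → Vec (Term Σ') n → (Var → Term Σ') → Vec (Term Σ') n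
    substs []       σ = []
    substs (t ∷ ts) σ = (t ⟨ σ ⟩) ∷ substs ts σ

  data _occursIn_ (x : Var) : Term Σ' → Set where
    here  : x occursIn var x
    there : ∀ {f ts} (i : Fin (ar Σ' f)) → x occursIn lookup ts i → x occursIn fun f ts

  IsVar : Term Σ' → Set
  IsVar (var _)   = ⊤
  IsVar (fun _ _) = ⊥

  RuleSet : Set₁
  RuleSet = Term Σ' → Term Σ' → Set

  _∪_ : RuleSet → RuleSet → RuleSet
  (R ∪ S) l r = R l r ⊎ S l r

  WellFormed : RuleSet → Set
  WellFormed R = ∀ l r → R l r → ¬ IsVar l × (∀ x → x occursIn r → x occursIn l)

  data Step (R : RuleSet) : Term Σ' → Term Σ' → Set where
    root : ∀ {l r} → R l r → (σ : Var → Term Σ') → Step R (l ⟨ σ ⟩) (r ⟨ σ ⟩)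
    arg  : ∀ {f} (ts : Vec (Term Σ') (ar Σ' f)) (i : Fin (ar Σ' f)) {u} →
           Step R (lookup ts i) u → Step R (fun f ts) (fun f (ts [ i ]≔ u))

  -- S / R is (relatively) terminating: there is no infinite (R ∪ S)-rewrite
  -- sequence containing infinitely many S-steps.
  RelTerminating : RuleSet → RuleSet → Set
  RelTerminating S R =
    ¬ (Σ (ℕ → Term Σ') λ t →
         (∀ i → Step R (t i) (t (suc i)) ⊎ Step S (t i) (t (suc i)))
       × (∀ n → ∃ λ i → n ≤ i × Step S (t i) (t (suc i))))

record TRS (Σ' : Signature) : Set₁ where
  field
    rules : RuleSet {Σ'}
    wf    : WellFormed rules
open TRS public

extend : (Σ' : Signature) (G : Set) → (G → ℕ) → Signature
extend Σ' G arG = record { Sym = Sym Σ' ⊎ G ; ar = λ { (inj₁ f) → ar Σ' f ; (inj₂ g) → arG g } }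

module _ {Σ' : Signature} {G : Set} {arG : G → ℕ} where
  mutual
    embed : Term Σ' → Term (extend Σ' G arG)
    embed (var x)    = var x
    embed (fun f ts) = fun (inj₁ f) (embeds ts)

    embeds : ∀ {n} → Vec (Term Σ') n → Vec (Term (extend Σ' G arG)) n
    embeds []       = []
    embeds (t ∷ ts) = embed t ∷ embeds ts

  liftRules : RuleSet {Σ'} → RuleSet {extend Σ' G arG}
  liftRules R l' r' = ∃ λ l → ∃ λ r → R l r × l' ≡ embed l × r' ≡ embed r

F◇ : Signature → Signature
F◇ Σ' = extend Σ' ⊤ (λ _ → 1)

◇Rule : {Σ' : Signature} → RuleSet {F◇ Σ'}
◇Rule l r = l ≡ fun (inj₂ tt) (var 0 ∷ []) × r ≡ var 0

-- Signature F extended by fresh constants ⊤ (= true) and ⊥ (= false)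
F⊤⊥ : Signature → Signature
F⊤⊥ Σ' = extend Σ' Bool (λ _ → 0)

⊤⊥Rule : {Σ' : Signature} → RuleSet {F⊤⊥ Σ'}
⊤⊥Rule l r = l ≡ fun (inj₂ true) [] × r ≡ fun (inj₂ false) []

BoundedDuplicating : {Σ' : Signature} → TRS Σ' → Set
BoundedDuplicating {Σ'} 𝓡 = RelTerminating {F◇ Σ'} ◇Rule (liftRules (rules 𝓡))

WeaklyBoundedDuplicating : {Σ' : Signature} → TRS Σ' → Set
WeaklyBoundedDuplicating {Σ'} 𝓡 = RelTerminating {F⊤⊥ Σ'} ⊤⊥Rule (liftRules (rules 𝓡))

module Submission where

-- Translate terms over F ∪ {⊤, ⊥} into terms over F ∪ {◇} by
-- the map  encode  which is the identity on F-symbols and variables and sends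
--   ⊤ ↦ ◇(x₀)   and   ⊥ ↦ x₀ .
-- It commutes with instantiating embedded F-terms, so it maps every R-step to
-- an R-step, and it maps every ⊤ → ⊥ step to a ◇(x) → x step (instance x := x₀).
-- Hence an infinite R ∪ {⊤ → ⊥} sequence with infinitely many ⊤ → ⊥ steps is
-- sent to an infinite R ∪ {◇(x) → x} sequence with infinitely many ◇-steps.

open import Defs
open import Data.Fin using (zero; suc)
open import Data.Vec using (Vec; []; _∷_; lookup; _[_]≔_)
open import Data.Product using (_,_)
open import Data.Sum using (inj₁; inj₂; map)
open import Data.Unit using (tt)
open import Data.Bool using (true; false)
open import Relation.Binary.PropositionalEquality
  using (_≡_; refl; cong; cong₂; subst; sym)

simulation-reflects-termination :
  {A B : Signature} {S R : RuleSet {A}} {S' R' : RuleSet {B}}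
  (f : Term A → Term B) →
  (∀ {s t} → Step R s t → Step R' (f s) (f t)) →
  (∀ {s t} → Step S s t → Step S' (f s) (f t)) →
  RelTerminating S' R' → RelTerminating S R
simulation-reflects-termination f simR simS terminating (t , steps , infinitelyOften) =
  terminating ( (λ i → f (t i))
              , (λ i → map simR simS (steps i))
              , λ n → let (i , n≤i , step) = infinitelyOften n in i , n≤i , simS step )

module _ {F : Signature} where

  mutual
    encode : Term (F⊤⊥ F) → Term (F◇ F)
    encode (var x)               = var x
    encode (fun (inj₁ f) ts)     = fun (inj₁ f) (encodes ts)
    encode (fun (inj₂ true) [])  = fun (inj₂ tt) (var 0 ∷ [])
    encode (fun (inj₂ false) []) = var 0

    encodes : ∀ {n} → Vec (Term (F⊤⊥ F)) n → Vec (Term (F◇ F)) n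
    encodes []       = []
    encodes (t ∷ ts) = encode t ∷ encodes ts

  lookup-encodes : ∀ {n} (ts : Vec (Term (F⊤⊥ F)) n) i →
    lookup (encodes ts) i ≡ encode (lookup ts i)
  lookup-encodes (t ∷ ts) zero    = refl
  lookup-encodes (t ∷ ts) (suc i) = lookup-encodes ts i

  encodes-update : ∀ {n} (ts : Vec (Term (F⊤⊥ F)) n) i u →
    encodes (ts [ i ]≔ u) ≡ encodes ts [ i ]≔ encode u
  encodes-update (t ∷ ts) zero    u = refl
  encodes-update (t ∷ ts) (suc i) u = cong (encode t ∷_) (encodes-update ts i u)

  mutual
    encode-instance : (l : Term F) (σ : Var → Term (F⊤⊥ F)) →
      encode (embed l ⟨ σ ⟩) ≡ embed l ⟨ (λ x → encode (σ x)) ⟩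
    encode-instance (var x)    σ = refl
    encode-instance (fun f ts) σ = cong (fun (inj₁ f)) (encodes-instances ts σ)

    encodes-instances : ∀ {n} (ts : Vec (Term F) n) (σ : Var → Term (F⊤⊥ F)) →
      encodes (substs (embeds ts) σ) ≡ substs (embeds ts) (λ x → encode (σ x))
    encodes-instances []       σ = refl
    encodes-instances (t ∷ ts) σ = cong₂ _∷_ (encode-instance t σ) (encodes-instances ts σ)

  -- encode is compatible with contexts: if it maps every root step of P to a
  -- Q-step, it maps every P-step to a Q-step.  (⊤ and ⊥ are constants, so only
  -- F-symbols have arguments to rewrite in.)
  encode-step : {P : RuleSet {F⊤⊥ F}} {Q : RuleSet {F◇ F}} →
    (∀ {l r} → P l r → ∀ σ → Step Q (encode (l ⟨ σ ⟩)) (encode (r ⟨ σ ⟩))) →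
    ∀ {s t} → Step P s t → Step Q (encode s) (encode t)
  encode-step rootStep (root lr σ) = rootStep lr σ
  encode-step {Q = Q} rootStep (arg {inj₁ f} ts i {u} step)
    rewrite encodes-update ts i u =
      arg (encodes ts) i
        (subst (λ v → Step Q v (encode u)) (sym (lookup-encodes ts i))
               (encode-step rootStep step))

  encode-R-root : (R : RuleSet {F}) → ∀ {l r} → liftRules R l r → ∀ σ →
    Step (liftRules R) (encode (l ⟨ σ ⟩)) (encode (r ⟨ σ ⟩))
  encode-R-root R (l , r , lr , refl , refl) σ
    rewrite encode-instance l σ | encode-instance r σ =
      root (l , r , lr , refl , refl) (λ x → encode (σ x))

  encode-⊤⊥-root : ∀ {l r} → ⊤⊥Rule l r → ∀ σ →
    Step ◇Rule (encode (l ⟨ σ ⟩)) (encode (r ⟨ σ ⟩))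
  encode-⊤⊥-root (refl , refl) σ = root (refl , refl) var

lemma6p13 : (Σ' : Signature) (𝓡 : TRS Σ') →
    BoundedDuplicating 𝓡 → WeaklyBoundedDuplicating 𝓡
lemma6p13 Σ' 𝓡 =
  simulation-reflects-termination encode
    (encode-step (encode-R-root (rules 𝓡)))
    (encode-step encode-⊤⊥-root)
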